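{- Let $\mathcal{E}$ be a bundle event structure and $x,y\in\mathcal{C}(\mathcal{E})$ with $x\subseteq y$. Then for every event trace $\alpha$ with $\bar\alpha=x$ there exists an event trace $\alpha'$ with $\bar{\alpha'}=y$ and $\alpha'|_x=\alpha$, where $\bar\beta$ denotes the set of events occurring in a trace $\beta$ and $\beta|_x$ its restriction (order-preserving subsequence) to events in $x$.
   Context: A bundle event structure (BES) is $\mathcal{E}=(E,\#,\mapsto,\lambda,\Phi)$: $E$ a set of events; $\#\subseteq E\times E$ irreflexive symmetric; for $x,y\subseteq E$, $x\#y$ means $e\#f$ for all $e\in x,f\in y$ with $e\neq f$; $\mapsto\subseteq\mathcal{P}(E)\times E$ with $x\mapsto e\Rightarrow x\#x$; $\lambda$ a partial labelling; $\Phi\subseteq E$ with $\Phi\#\Phi$. Let $\mathrm{cfl}(x)=\{e\mid\exists e'\in x:e\#e'\}$. An event trace is a finite sequence $e_1\cdots e_n$ such that for each $i$, $e_i\notin\mathrm{cfl}(\{e_1,\dots,e_{i-1}\})\cup\{e_1,\dots,e_{i-1}\}$ and for each bundle $z\mapsto e_i$ there is $j<i$ with $e_j\in z$. A configuration is the set of events of an event trace; $\mathcal{C}(\mathcal{E})$ is the set of configurations. -}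

module Defs where

open import Data.List using (List; []; _∷_; _++_; [_])
open import Data.List.Membership.Propositional using (_∈_)
open import Data.Maybe using (Maybe)
open import Data.Product using (Σ; ∃; _×_; _,_)
open import Data.Empty using (⊥)
open import Relation.Nullary using (¬_)
open import Relation.Binary.PropositionalEquality using (_≡_)

Pred : Set → Set₁
Pred E = E → Set

record BES : Set₁ where
  field
    Ev     : Set
    Label  : Set
    _#_    : Ev → Ev → Set
    #-irrefl : ∀ e → ¬ (e # e)
    #-sym    : ∀ e f → e # f → f # e
    _↦_    : Pred Ev → Ev → Set
    bundle-conflict : ∀ x e → x ↦ e → ∀ f g → x f → x g → ¬ (f ≡ g) → f # g
    lab    : Ev → Maybe Label
    Φ      : Pred Ev
    Φ-conflict : ∀ f g → Φ f → Φ g → ¬ (f ≡ g) → f # g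

module _ (𝓔 : BES) where
  open BES 𝓔

  InCfl : Ev → List Ev → Set
  InCfl e α = Σ Ev λ e' → e' ∈ α × (e # e')

  data EventTrace : List Ev → Set₁ where
    []ᵗ  : EventTrace []
    snoc : ∀ {α} e → EventTrace α
         → ¬ InCfl e α
         → ¬ (e ∈ α)
         → (∀ z → z ↦ e → Σ Ev λ e' → e' ∈ α × z e')
         → EventTrace (α ++ [ e ])

  _hasEvents_ : List Ev → Pred Ev → Set
  β hasEvents x = ∀ e → (e ∈ β → x e) × (x e → e ∈ β)

  IsConfiguration : Pred Ev → Set₁
  IsConfiguration x = Σ (List Ev) λ β → EventTrace β × (β hasEvents x)

  data Restrict (x : Pred Ev) : List Ev → List Ev → Set where
    []ʳ   : Restrict x [] []
    keep  : ∀ {β γ} e → x e → Restrict x β γ → Restrict x (e ∷ β) (e ∷ γ)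
    skip  : ∀ {β γ} e → ¬ x e → Restrict x β γ → Restrict x (e ∷ β) γ

_⊆ₚ_ : ∀ {E : Set} → Pred E → Pred E → Set
x ⊆ₚ y = ∀ e → x e → y e

-- Let β be a trace of y. Walking along β and appending to α every event not in x
-- yields a trace: conflict-freeness of the appended event holds because all events
-- involved lie in the configuration y, and every bundle pointing to it is already
-- satisfied by an earlier event of β, which is in x (hence in α) or was appended.
-- Whether an event of β lies in x is decidable because both are listed by traces.
module Submission where

open import Defs
open import Data.List using (List; []; _∷_; _++_; [_])
open import Data.List.Membership.Propositional using (_∈_)
open import Data.List.Membership.Propositional.Properties using (∈-++⁻; ∈-++⁺ˡ; ∈-++⁺ʳ)
open import Data.List.Relation.Binary.Subset.Propositional using (_⊆_)
open import Data.List.Relation.Unary.Any using (here; there)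
open import Data.List.Relation.Unary.Any.Properties using (singleton⁻)
open import Data.Product using (Σ; _×_; _,_; proj₁; proj₂)
open import Data.Sum using (_⊎_; inj₁; inj₂; [_,_]′; map₂)
open import Function using (_∘_; id)
open import Relation.Nullary using (¬_; Dec; yes; no)
open import Relation.Nullary.Decidable using (map′)
open import Relation.Unary using (_∪_)
open import Relation.Binary.PropositionalEquality using (_≡_; refl)

∈-∷ʳ⁻ : ∀ {A : Set} {xs : List A} {x v} → v ∈ xs ++ [ x ] → v ∈ xs ⊎ v ≡ x
∈-∷ʳ⁻ {xs = xs} = map₂ singleton⁻ ∘ ∈-++⁻ xs

module _ (𝓔 : BES) where
  open BES 𝓔

  -- Events carry no decidable equality, but events of one trace can be compared
  -- by their position in it, since a trace never repeats an event.
  trace-≟ : ∀ {β} → EventTrace 𝓔 β → ∀ {e f} → e ∈ β → f ∈ β → Dec (e ≡ f)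
  trace-≟ (snoc n β-trace _ n∉β _) e∈ f∈ with ∈-∷ʳ⁻ e∈ | ∈-∷ʳ⁻ f∈
  ... | inj₁ e∈β | inj₁ f∈β = trace-≟ β-trace e∈β f∈β
  ... | inj₁ e∈β | inj₂ refl = no λ { refl → n∉β e∈β }
  ... | inj₂ refl | inj₁ f∈β = no λ { refl → n∉β f∈β }
  ... | inj₂ refl | inj₂ refl = yes refl

  trace-∈? : ∀ {β} → EventTrace 𝓔 β → (α : List Ev) → α ⊆ β → ∀ {e} → e ∈ β → Dec (e ∈ α)
  trace-∈? _ [] _ _ = no λ ()
  trace-∈? β-trace (a ∷ α) a∷α⊆β e∈β
    with trace-≟ β-trace e∈β (a∷α⊆β (here refl)) | trace-∈? β-trace α (a∷α⊆β ∘ there) e∈β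
  ... | yes e≡a | _ = yes (here e≡a)
  ... | no _ | yes e∈α = yes (there e∈α)
  ... | no e≢a | no e∉α = no λ { (here e≡a) → e≢a e≡a ; (there e∈α) → e∉α e∈α }

  trace-conflictFree : ∀ {β} → EventTrace 𝓔 β → ∀ {e f} → e ∈ β → f ∈ β → ¬ e # f
  trace-conflictFree (snoc n β-trace n∉cfl _ _) e∈ f∈ with ∈-∷ʳ⁻ e∈ | ∈-∷ʳ⁻ f∈
  ... | inj₁ e∈β | inj₁ f∈β = trace-conflictFree β-trace e∈β f∈β
  ... | inj₁ e∈β | inj₂ refl = λ e#n → n∉cfl (_ , e∈β , #-sym _ _ e#n)
  ... | inj₂ refl | inj₁ f∈β = λ n#f → n∉cfl (_ , f∈β , n#f)
  ... | inj₂ refl | inj₂ refl = #-irrefl n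

  hasEvents-cong : ∀ {γ} {P Q : Pred Ev} → (∀ e → P e → Q e) → (∀ e → Q e → P e)
                 → _hasEvents_ 𝓔 γ P → _hasEvents_ 𝓔 γ Q
  hasEvents-cong P⇒Q Q⇒P γP e = P⇒Q e ∘ proj₁ (γP e) , proj₂ (γP e) ∘ Q⇒P e

  hasEvents-∪-∷ʳ : ∀ {γ β e} {x : Pred Ev} → _hasEvents_ 𝓔 γ (x ∪ (_∈ β))
                 → _hasEvents_ 𝓔 (γ ++ [ e ]) (x ∪ (_∈ β ++ [ e ]))
  hasEvents-∪-∷ʳ {γ} {β} {e} {x} γxβ f = to , from
    where
    to : f ∈ γ ++ [ e ] → (x ∪ (_∈ β ++ [ e ])) f
    to f∈ with ∈-∷ʳ⁻ f∈
    ... | inj₁ f∈γ = map₂ ∈-++⁺ˡ (proj₁ (γxβ f) f∈γ)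
    ... | inj₂ refl = inj₂ (∈-++⁺ʳ β (here refl))
    from : (x ∪ (_∈ β ++ [ e ])) f → f ∈ γ ++ [ e ]
    from (inj₁ xf) = ∈-++⁺ˡ (proj₂ (γxβ f) (inj₁ xf))
    from (inj₂ f∈) with ∈-∷ʳ⁻ f∈
    ... | inj₁ f∈β = ∈-++⁺ˡ (proj₂ (γxβ f) (inj₂ f∈β))
    ... | inj₂ refl = ∈-++⁺ʳ γ (here refl)

  hasEvents-∪-absorb : ∀ {γ β e} {x : Pred Ev} → x e → _hasEvents_ 𝓔 γ (x ∪ (_∈ β))
                     → _hasEvents_ 𝓔 γ (x ∪ (_∈ β ++ [ e ]))
  hasEvents-∪-absorb {β = β} {e} {x} xe = hasEvents-cong (λ _ → map₂ ∈-++⁺ˡ) absorb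
    where
    absorb : ∀ f → (x ∪ (_∈ β ++ [ e ])) f → (x ∪ (_∈ β)) f
    absorb f (inj₁ xf) = inj₁ xf
    absorb f (inj₂ f∈) with ∈-∷ʳ⁻ f∈
    ... | inj₁ f∈β = inj₂ f∈β
    ... | inj₂ refl = inj₁ xe

  restrict-self : ∀ {x : Pred Ev} {α} → (∀ e → e ∈ α → x e) → Restrict 𝓔 x α α
  restrict-self {α = []} _ = []ʳ
  restrict-self {α = e ∷ α} αx = keep e (αx e (here refl)) (restrict-self (λ f → αx f ∘ there))

  restrict-∷ʳ-skip : ∀ {x : Pred Ev} {γ α e} → ¬ x e → Restrict 𝓔 x γ α → Restrict 𝓔 x (γ ++ [ e ]) α
  restrict-∷ʳ-skip {e = e} ¬xe []ʳ = skip e ¬xe []ʳ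
  restrict-∷ʳ-skip ¬xe (keep f xf r) = keep f xf (restrict-∷ʳ-skip ¬xe r)
  restrict-∷ʳ-skip ¬xe (skip f ¬xf r) = skip f ¬xf (restrict-∷ʳ-skip ¬xe r)

  record Extension (x : Pred Ev) (α β : List Ev) : Set₁ where
    constructor extension
    field
      {trace}   : List Ev
      isTrace   : EventTrace 𝓔 trace
      restricts : Restrict 𝓔 x trace α
      events    : _hasEvents_ 𝓔 trace (x ∪ (_∈ β))

  module _ {x y : Pred Ev} (x⊆y : x ⊆ₚ y) (x? : ∀ e → y e → Dec (x e))
           (y-conflictFree : ∀ e f → y e → y f → ¬ e # f) where

    extension-∷ʳ : ∀ {α β e} → (∀ f → f ∈ β → y f) → y e → ¬ e ∈ β
                 → (∀ z → z ↦ e → Σ Ev λ f → f ∈ β × z f)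
                 → Extension x α β → Extension x α (β ++ [ e ])
    extension-∷ʳ {e = e} βy ye e∉β e-enabled (extension {γ} γ-trace γα γxβ)
      with x? e ye
    ... | yes xe = extension γ-trace γα (hasEvents-∪-absorb xe γxβ)
    ... | no ¬xe = extension (snoc e γ-trace e∉cfl e∉γ e-enabledγ)
                             (restrict-∷ʳ-skip ¬xe γα) (hasEvents-∪-∷ʳ γxβ)
      where
      γy : ∀ f → f ∈ γ → y f
      γy f = [ x⊆y f , βy f ]′ ∘ proj₁ (γxβ f)
      e∉cfl : ¬ InCfl 𝓔 e γ
      e∉cfl (f , f∈γ , e#f) = y-conflictFree e f ye (γy f f∈γ) e#f
      e∉γ : ¬ e ∈ γ
      e∉γ = [ ¬xe , e∉β ]′ ∘ proj₁ (γxβ e)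
      e-enabledγ : ∀ z → z ↦ e → Σ Ev λ f → f ∈ γ × z f
      e-enabledγ z z↦e with e-enabled z z↦e
      ... | f , f∈β , zf = f , proj₂ (γxβ f) (inj₂ f∈β) , zf

    extend : ∀ {α β} → EventTrace 𝓔 α → _hasEvents_ 𝓔 α x
           → EventTrace 𝓔 β → (∀ f → f ∈ β → y f) → Extension x α β
    extend α-trace αx []ᵗ _ =
      extension α-trace (restrict-self (proj₁ ∘ αx)) (hasEvents-cong (λ _ → inj₁) from-x∪[] αx)
      where
      from-x∪[] : ∀ f → (x ∪ (_∈ [])) f → x f
      from-x∪[] f = [ id , (λ ()) ]′
    extend α-trace αx (snoc {β} e β-trace _ e∉β e-enabled) βey =
      extension-∷ʳ βy (βey e (∈-++⁺ʳ β (here refl))) e∉β e-enabled (extend α-trace αx β-trace βy)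
      where
      βy : ∀ f → f ∈ β → y f
      βy f = βey f ∘ ∈-++⁺ˡ

lemma2 : (𝓔 : BES) → (x y : Pred (BES.Ev 𝓔))
    → IsConfiguration 𝓔 x → IsConfiguration 𝓔 y → x ⊆ₚ y
    → (α : List (BES.Ev 𝓔)) → EventTrace 𝓔 α → _hasEvents_ 𝓔 α x
    → Σ (List (BES.Ev 𝓔)) (λ α' → EventTrace 𝓔 α' × _hasEvents_ 𝓔 α' y × Restrict 𝓔 x α' α)
-- That x is a configuration is already witnessed by α.
lemma2 𝓔 x y _ (β , β-trace , βy) x⊆y α α-trace αx =
  trace , isTrace , hasEvents-cong 𝓔 x∪β⇒y y⇒x∪β events , restricts
  where
  x? : ∀ e → y e → Dec (x e)
  x? e ye = map′ (proj₁ (αx e)) (proj₂ (αx e))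
                 (trace-∈? 𝓔 β-trace α (proj₂ (βy _) ∘ x⊆y _ ∘ proj₁ (αx _)) (proj₂ (βy e) ye))
  y-conflictFree : ∀ e f → y e → y f → ¬ BES._#_ 𝓔 e f
  y-conflictFree e f ye yf = trace-conflictFree 𝓔 β-trace (proj₂ (βy e) ye) (proj₂ (βy f) yf)
  x∪β⇒y : ∀ e → (x ∪ (_∈ β)) e → y e
  x∪β⇒y e = [ x⊆y e , proj₁ (βy e) ]′
  y⇒x∪β : ∀ e → y e → (x ∪ (_∈ β)) e
  y⇒x∪β e = inj₂ ∘ proj₂ (βy e)
  open Extension (extend 𝓔 x⊆y x? y-conflictFree α-trace αx β-trace (proj₁ ∘ βy))
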